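{- For any nonnegative integer $n$, $$\sum_{k=0}^n\binom{n}{k}^{ -2}=(n+1)^2\sum_{k=0}^n\left[\sum_{i=0}^k\frac{(-1)^i}{n-k+1+i}\binom{k}{i}\right]^2=(n+1)^2\sum_{k=0}^n\frac{2}{n-k+1}\sum_{i=0}^k\frac{(-1)^i}{n+2+i}\binom{k}{i}.$$ -}

module Defs where

open import Data.Nat using (ℕ; zero; suc; _∸_)
open import Data.Integer using (ℤ; +_; -[1+_])
open import Data.Rational using (ℚ; 0ℚ; _+_; _/_)

Σ[0…_] : ℕ → (ℕ → ℚ) → ℚ
Σ[0… zero ] f = f 0
Σ[0… suc n ] f = Σ[0… n ] f + f (suc n)

-- reciprocal of a natural number as a rational; 1/0 := 0 (junk value,
-- never used below since every denominator in the statement is positive)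
recipℕ : ℕ → ℚ
recipℕ zero = 0ℚ
recipℕ (suc m) = + 1 / suc m

sgn : ℕ → ℚ
sgn zero = + 1 / 1
sgn (suc zero) = -[1+ 0 ] / 1
sgn (suc (suc i)) = sgn i

ℕ→ℚ : ℕ → ℚ
ℕ→ℚ m = + m / 1

module Submission where

-- Let β(m, k) = Σᵢ (-1)ⁱ C(k, i) / (m + 1 + i), the binomial expansion of the Beta
-- integral B(m + 1, k + 1). Pascal's rule gives β(m, k + 1) = β(m, k) - β(m + 1, k),
-- hence β(m, k) = m! k! / (m + k + 1)! and 1 / C(n, k) = (n + 1) β(n - k, k): this is
-- the first identity. For the second, A(n) = Σₖ 1 / C(n, k)² and 2 (n + 1)² B(n), with
-- B(n) = Σₖ β(n + 1, k) / (n - k + 1), satisfy the same first-order recurrence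
-- (n + 2)³ X(n) + 6 (n + 1)² (n + 2) = 2 (n + 1)² (2n + 5) X(n + 1), each obtained by
-- creative telescoping with an explicit rational certificate, and they agree at n = 0.

open import Defs
import Data.Nat as ℕ
import Data.Nat.Properties as ℕP
open import Data.Nat using (ℕ; zero; suc; _∸_; _!; _≤_; _<_; z≤n; NonZero)
open import Data.Nat.Combinatorics
  using (_C_; nCk+nC[k+1]≡[n+1]C[k+1]; k>n⇒nCk≡0; nCk≡n!/k![n-k]!; k![n∸k]!∣n!; nCn≡1)
open import Data.Nat.DivMod using (m/n*n≡m)
import Data.Integer as ℤ
import Data.Integer.Properties as ℤ
open import Data.Rational using (ℚ; _+_; _*_; _-_; -_; 0ℚ; 1ℚ; toℚᵘ)
open import Data.Rational.Properties
  using ( toℚᵘ-injective; toℚᵘ-fromℚᵘ; toℚᵘ-homo-+; toℚᵘ-homo-*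
        ; +-assoc; +-comm; +-identityˡ; +-identityʳ; *-assoc; *-comm; *-identityˡ; *-zeroˡ; *-zeroʳ; *-distribˡ-+)
import Data.Rational.Unnormalised as ℚᵘ
import Data.Rational.Unnormalised.Properties as ℚᵘ
open import Data.Rational.Solver using (module +-*-Solver)
open import Data.Empty using (⊥-elim)
open import Data.Product using (_×_; _,_)
open import Function using (_∘_)
open import Relation.Binary.PropositionalEquality
open +-*-Solver
open ≡-Reasoning

toℚᵘ-ℕ→ℚ : ∀ m → toℚᵘ (ℕ→ℚ m) ℚᵘ.≃ ℚᵘ.mkℚᵘ (ℤ.+ m) 0
toℚᵘ-ℕ→ℚ m = toℚᵘ-fromℚᵘ (ℚᵘ.mkℚᵘ (ℤ.+ m) 0)

ℕ→ℚ-suc : ∀ m → ℕ→ℚ (suc m) ≡ 1ℚ + ℕ→ℚ m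
ℕ→ℚ-suc m = toℚᵘ-injective (ℚᵘ.≃-trans (toℚᵘ-ℕ→ℚ (suc m)) (ℚᵘ.≃-sym (ℚᵘ.≃-trans
  (toℚᵘ-homo-+ 1ℚ (ℕ→ℚ m))
  (ℚᵘ.≃-trans (ℚᵘ.+-congʳ (toℚᵘ 1ℚ) (toℚᵘ-ℕ→ℚ m)) (ℚᵘ.*≡* cross-multiplied)))))
  where
  cross-multiplied : (ℤ.+ 1 ℤ.* ℤ.+ 1 ℤ.+ ℤ.+ m ℤ.* ℤ.+ 1) ℤ.* ℤ.+ 1 ≡ ℤ.+ suc m ℤ.* (ℤ.+ 1 ℤ.* ℤ.+ 1)
  cross-multiplied = trans (ℤ.*-identityʳ _)
    (trans (cong (ℤ._+_ (ℤ.+ 1)) (ℤ.*-identityʳ (ℤ.+ m))) (sym (ℤ.*-identityʳ (ℤ.+ suc m))))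

ℕ→ℚ-+ : ∀ m n → ℕ→ℚ (m ℕ.+ n) ≡ ℕ→ℚ m + ℕ→ℚ n
ℕ→ℚ-+ zero    n = sym (+-identityˡ (ℕ→ℚ n))
ℕ→ℚ-+ (suc m) n = begin
  ℕ→ℚ (suc (m ℕ.+ n))     ≡⟨ ℕ→ℚ-suc (m ℕ.+ n) ⟩
  1ℚ + ℕ→ℚ (m ℕ.+ n)      ≡⟨ cong (1ℚ +_) (ℕ→ℚ-+ m n) ⟩
  1ℚ + (ℕ→ℚ m + ℕ→ℚ n)    ≡⟨ sym (+-assoc 1ℚ (ℕ→ℚ m) (ℕ→ℚ n)) ⟩
  (1ℚ + ℕ→ℚ m) + ℕ→ℚ n    ≡⟨ cong (_+ ℕ→ℚ n) (sym (ℕ→ℚ-suc m)) ⟩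
  ℕ→ℚ (suc m) + ℕ→ℚ n     ∎

ℕ→ℚ-* : ∀ m n → ℕ→ℚ (m ℕ.* n) ≡ ℕ→ℚ m * ℕ→ℚ n
ℕ→ℚ-* zero    n = sym (*-zeroˡ (ℕ→ℚ n))
ℕ→ℚ-* (suc m) n = begin
  ℕ→ℚ (n ℕ.+ m ℕ.* n)          ≡⟨ ℕ→ℚ-+ n (m ℕ.* n) ⟩
  ℕ→ℚ n + ℕ→ℚ (m ℕ.* n)        ≡⟨ cong (ℕ→ℚ n +_) (ℕ→ℚ-* m n) ⟩
  ℕ→ℚ n + ℕ→ℚ m * ℕ→ℚ n        ≡⟨ solve 2 (λ M N → N :+ M :* N := (con 1ℚ :+ M) :* N) refl (ℕ→ℚ m) (ℕ→ℚ n) ⟩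
  (1ℚ + ℕ→ℚ m) * ℕ→ℚ n         ≡⟨ cong (_* ℕ→ℚ n) (sym (ℕ→ℚ-suc m)) ⟩
  ℕ→ℚ (suc m) * ℕ→ℚ n          ∎

ℕ→ℚ-suc-! : ∀ m → ℕ→ℚ (suc m !) ≡ (1ℚ + ℕ→ℚ m) * ℕ→ℚ (m !)
ℕ→ℚ-suc-! m = trans (ℕ→ℚ-* (suc m) (m !)) (cong (_* ℕ→ℚ (m !)) (ℕ→ℚ-suc m))

recipℕ-inverse : ∀ m .{{_ : NonZero m}} → recipℕ m * ℕ→ℚ m ≡ 1ℚ
recipℕ-inverse zero    = ⊥-elim (ℕ.≢-nonZero⁻¹ 0 refl)
recipℕ-inverse (suc m) = toℚᵘ-injective (ℚᵘ.≃-trans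
  (toℚᵘ-homo-* (recipℕ (suc m)) (ℕ→ℚ (suc m)))
  (ℚᵘ.≃-trans (ℚᵘ.*-cong (toℚᵘ-fromℚᵘ (ℚᵘ.mkℚᵘ (ℤ.+ 1) m)) (toℚᵘ-ℕ→ℚ (suc m))) (ℚᵘ.*≡* (ℤ.*-assoc (ℤ.+ 1) (ℤ.+ suc m) (ℤ.+ 1)))))

*-cancelʳ-invertible : ∀ {x y c} c⁻¹ → c⁻¹ * c ≡ 1ℚ → x * c ≡ y * c → x ≡ y
*-cancelʳ-invertible {x} {y} {c} c⁻¹ c⁻¹c≡1 xc≡yc = begin
  x                ≡⟨ solve 1 (λ x → x := x :* con 1ℚ) refl x ⟩
  x * 1ℚ           ≡⟨ cong (x *_) (sym c⁻¹c≡1) ⟩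
  x * (c⁻¹ * c)    ≡⟨ solve 3 (λ x a b → x :* (a :* b) := (x :* b) :* a) refl x c⁻¹ c ⟩
  (x * c) * c⁻¹    ≡⟨ cong (_* c⁻¹) xc≡yc ⟩
  (y * c) * c⁻¹    ≡⟨ solve 3 (λ y a b → (y :* b) :* a := y :* (a :* b)) refl y c⁻¹ c ⟩
  y * (c⁻¹ * c)    ≡⟨ cong (y *_) c⁻¹c≡1 ⟩
  y * 1ℚ           ≡⟨ solve 1 (λ y → y :* con 1ℚ := y) refl y ⟩
  y                ∎

*-cancelʳ-ℕ→ℚ : ∀ m .{{_ : NonZero m}} {x y} → x * ℕ→ℚ m ≡ y * ℕ→ℚ m → x ≡ y
*-cancelʳ-ℕ→ℚ m = *-cancelʳ-invertible (recipℕ m) (recipℕ-inverse m)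

recipℕ-unique : ∀ m .{{_ : NonZero m}} {x} → x * ℕ→ℚ m ≡ 1ℚ → x ≡ recipℕ m
recipℕ-unique m xm≡1 = *-cancelʳ-ℕ→ℚ m (trans xm≡1 (sym (recipℕ-inverse m)))

square-of-product : ∀ {x} c φ → x ≡ c * φ → x * x ≡ c * c * (φ * φ)
square-of-product c φ refl = solve 2 (λ c φ → (c :* φ) :* (c :* φ) := c :* c :* (φ :* φ)) refl c φ

Σ-cong : ∀ n {f g : ℕ → ℚ} → (∀ {k} → k ≤ n → f k ≡ g k) → Σ[0… n ] f ≡ Σ[0… n ] g
Σ-cong zero    f≗g = f≗g z≤n
Σ-cong (suc n) f≗g = cong₂ _+_ (Σ-cong n (f≗g ∘ ℕP.m≤n⇒m≤1+n)) (f≗g ℕP.≤-refl)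

Σ-*ˡ : ∀ n c (f : ℕ → ℚ) → Σ[0… n ] (λ k → c * f k) ≡ c * Σ[0… n ] f
Σ-*ˡ zero    c f = refl
Σ-*ˡ (suc n) c f = trans (cong (_+ c * f (suc n)) (Σ-*ˡ n c f)) (sym (*-distribˡ-+ c (Σ[0… n ] f) (f (suc n))))

Σ-distrib-- : ∀ n (f g : ℕ → ℚ) → Σ[0… n ] (λ k → f k - g k) ≡ Σ[0… n ] f - Σ[0… n ] g
Σ-distrib-- zero    f g = refl
Σ-distrib-- (suc n) f g = trans (cong (_+ (f (suc n) - g (suc n))) (Σ-distrib-- n f g))
  (solve 4 (λ F G x y → (F :- G) :+ (x :- y) := (F :+ x) :- (G :+ y)) refl
    (Σ[0… n ] f) (Σ[0… n ] g) (f (suc n)) (g (suc n)))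

Σ-uncons : ∀ n (f : ℕ → ℚ) → Σ[0… suc n ] f ≡ f 0 + Σ[0… n ] (f ∘ suc)
Σ-uncons zero    f = refl
Σ-uncons (suc n) f = trans (cong (_+ f (2 ℕ.+ n)) (Σ-uncons n f))
  (+-assoc (f 0) (Σ[0… n ] (f ∘ suc)) (f (2 ℕ.+ n)))

Σ-telescope : ∀ n (H G : ℕ → ℚ) → (∀ {k} → k < n → H k ≡ G (suc k)) →
              Σ[0… n ] (λ k → H k - G k) ≡ H n - G 0
Σ-telescope zero    H G H≡G∘suc = refl
Σ-telescope (suc n) H G H≡G∘suc = begin
  Σ[0… n ] (λ k → H k - G k) + (H (suc n) - G (suc n))
    ≡⟨ cong (_+ (H (suc n) - G (suc n))) (Σ-telescope n H G (H≡G∘suc ∘ ℕP.m<n⇒m<1+n)) ⟩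
  (H n - G 0) + (H (suc n) - G (suc n))
    ≡⟨ cong (λ x → (x - G 0) + (H (suc n) - G (suc n))) (H≡G∘suc ℕP.≤-refl) ⟩
  (G (suc n) - G 0) + (H (suc n) - G (suc n))
    ≡⟨ solve 3 (λ a b c → (a :- b) :+ (c :- a) := c :- b) refl (G (suc n)) (G 0) (H (suc n)) ⟩
  H (suc n) - G 0 ∎

creative-telescoping : ∀ n α β (f g H G : ℕ → ℚ) →
  (∀ {k} → k ≤ n → α * f k - β * g k ≡ H k - G k) →
  (∀ {k} → k < n → H k ≡ G (suc k)) →
  α * Σ[0… n ] f - β * Σ[0… n ] g ≡ H n - G 0
creative-telescoping n α β f g H G certificate H≡G∘suc = begin
  α * Σ[0… n ] f - β * Σ[0… n ] g
    ≡⟨ sym (cong₂ _-_ (Σ-*ˡ n α f) (Σ-*ˡ n β g)) ⟩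
  Σ[0… n ] (λ k → α * f k) - Σ[0… n ] (λ k → β * g k)
    ≡⟨ sym (Σ-distrib-- n _ _) ⟩
  Σ[0… n ] (λ k → α * f k - β * g k)
    ≡⟨ Σ-cong n certificate ⟩
  Σ[0… n ] (λ k → H k - G k)
    ≡⟨ Σ-telescope n H G H≡G∘suc ⟩
  H n - G 0 ∎

neg-sgn-suc : ∀ i → - sgn (suc i) ≡ sgn i
neg-sgn-suc zero          = refl
neg-sgn-suc (suc zero)    = refl
neg-sgn-suc (suc (suc i)) = neg-sgn-suc i

betaSum : ℕ → ℕ → ℚ
betaSum m k = Σ[0… k ] (λ i → sgn i * recipℕ (suc (m ℕ.+ i)) * ℕ→ℚ (k C i))

betaSum-pascal : ∀ m k → betaSum m (suc k) ≡ betaSum m k - betaSum (suc m) k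
betaSum-pascal m k = begin
  betaSum m (suc k)
    ≡⟨ Σ-uncons k (term m (suc k)) ⟩
  term m k 0 + Σ[0… k ] (term m (suc k) ∘ suc)
    ≡⟨ cong (term m k 0 +_) (trans (Σ-cong k (λ {i} _ → pascal-term i)) (Σ-distrib-- k _ _)) ⟩
  term m k 0 + (Σ[0… k ] (term m k ∘ suc) - betaSum (suc m) k)
    ≡⟨ sym (+-assoc (term m k 0) _ _) ⟩
  (term m k 0 + Σ[0… k ] (term m k ∘ suc)) - betaSum (suc m) k
    ≡⟨ cong (_- betaSum (suc m) k) (sym (Σ-uncons k (term m k))) ⟩
  (betaSum m k + term m k (suc k)) - betaSum (suc m) k
    ≡⟨ cong (λ x → (betaSum m k + x) - betaSum (suc m) k) top-term-vanishes ⟩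
  (betaSum m k + 0ℚ) - betaSum (suc m) k
    ≡⟨ cong (_- betaSum (suc m) k) (+-identityʳ (betaSum m k)) ⟩
  betaSum m k - betaSum (suc m) k ∎
  where
  term : ℕ → ℕ → ℕ → ℚ
  term p q i = sgn i * recipℕ (suc (p ℕ.+ i)) * ℕ→ℚ (q C i)

  top-term-vanishes : term m k (suc k) ≡ 0ℚ
  top-term-vanishes rewrite k>n⇒nCk≡0 (ℕP.n<1+n k) = *-zeroʳ (sgn (suc k) * recipℕ (suc (m ℕ.+ suc k)))

  pascal-term : ∀ i → term m (suc k) (suc i) ≡ term m k (suc i) - term (suc m) k i
  pascal-term i = begin
    s * ρ * ℕ→ℚ (suc k C suc i)
      ≡⟨ cong (λ c → s * ρ * ℕ→ℚ c) (sym (nCk+nC[k+1]≡[n+1]C[k+1] k i)) ⟩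
    s * ρ * ℕ→ℚ (k C i ℕ.+ k C suc i)
      ≡⟨ cong (s * ρ *_) (ℕ→ℚ-+ (k C i) (k C suc i)) ⟩
    s * ρ * (ℕ→ℚ (k C i) + ℕ→ℚ (k C suc i))
      ≡⟨ solve 4 (λ s ρ a b → s :* ρ :* (a :+ b) := s :* ρ :* b :- (:- s) :* ρ :* a) refl
           s ρ (ℕ→ℚ (k C i)) (ℕ→ℚ (k C suc i)) ⟩
    s * ρ * ℕ→ℚ (k C suc i) - (- s) * ρ * ℕ→ℚ (k C i)
      ≡⟨ cong₂ (λ s′ j → s * ρ * ℕ→ℚ (k C suc i) - s′ * recipℕ (suc j) * ℕ→ℚ (k C i))
           (neg-sgn-suc i) (ℕP.+-suc m i) ⟩
    s * ρ * ℕ→ℚ (k C suc i) - sgn i * recipℕ (suc (suc m ℕ.+ i)) * ℕ→ℚ (k C i) ∎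
    where
    s ρ : ℚ
    s = sgn (suc i)
    ρ = recipℕ (suc (m ℕ.+ suc i))

betaSum-factorial : ∀ m k → betaSum m k * ℕ→ℚ (suc (k ℕ.+ m) !) ≡ ℕ→ℚ (k !) * ℕ→ℚ (m !)
betaSum-factorial m zero = begin
  1ℚ * recipℕ (suc (m ℕ.+ 0)) * 1ℚ * ℕ→ℚ (suc m !)
    ≡⟨ cong₂ (λ j x → 1ℚ * recipℕ (suc j) * 1ℚ * x) (ℕP.+-identityʳ m) (ℕ→ℚ-* (suc m) (m !)) ⟩
  1ℚ * recipℕ (suc m) * 1ℚ * (ℕ→ℚ (suc m) * ℕ→ℚ (m !))
    ≡⟨ solve 3 (λ r s f → con 1ℚ :* r :* con 1ℚ :* (s :* f) := (r :* s) :* f) refl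
         (recipℕ (suc m)) (ℕ→ℚ (suc m)) (ℕ→ℚ (m !)) ⟩
  (recipℕ (suc m) * ℕ→ℚ (suc m)) * ℕ→ℚ (m !)
    ≡⟨ cong (_* ℕ→ℚ (m !)) (recipℕ-inverse (suc m)) ⟩
  1ℚ * ℕ→ℚ (m !) ∎
betaSum-factorial m (suc k) = begin
  betaSum m (suc k) * ℕ→ℚ (s ℕ.* f)
    ≡⟨ cong₂ _*_ (betaSum-pascal m k) (ℕ→ℚ-* s f) ⟩
  (b - b′) * (ℕ→ℚ s * ℕ→ℚ f)
    ≡⟨ solve 4 (λ b b′ S F → (b :- b′) :* (S :* F) := S :* (b :* F) :- b′ :* (S :* F)) refl b b′ (ℕ→ℚ s) (ℕ→ℚ f) ⟩
  ℕ→ℚ s * (b * ℕ→ℚ f) - b′ * (ℕ→ℚ s * ℕ→ℚ f)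
    ≡⟨ cong₂ (λ x y → ℕ→ℚ s * x - y) (betaSum-factorial m k) b′-factorial ⟩
  ℕ→ℚ s * (ℕ→ℚ (k !) * ℕ→ℚ (m !)) - ℕ→ℚ (k !) * ℕ→ℚ (suc m !)
    ≡⟨ cong₂ (λ x y → x * (ℕ→ℚ (k !) * ℕ→ℚ (m !)) - ℕ→ℚ (k !) * y)
         (trans (ℕ→ℚ-+ 2 (k ℕ.+ m)) (cong (ℕ→ℚ 2 +_) (ℕ→ℚ-+ k m))) (ℕ→ℚ-suc-! m) ⟩
  (ℕ→ℚ 2 + (K + M)) * (ℕ→ℚ (k !) * ℕ→ℚ (m !)) - ℕ→ℚ (k !) * ((1ℚ + M) * ℕ→ℚ (m !))
    ≡⟨ solve 4 (λ K M k! m! → (con (ℕ→ℚ 2) :+ (K :+ M)) :* (k! :* m!) :- k! :* ((con 1ℚ :+ M) :* m!)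
                             := (con 1ℚ :+ K) :* k! :* m!) refl K M (ℕ→ℚ (k !)) (ℕ→ℚ (m !)) ⟩
  (1ℚ + K) * ℕ→ℚ (k !) * ℕ→ℚ (m !)
    ≡⟨ cong (_* ℕ→ℚ (m !)) (sym (ℕ→ℚ-suc-! k)) ⟩
  ℕ→ℚ (suc k !) * ℕ→ℚ (m !) ∎
  where
  s f : ℕ
  s = 2 ℕ.+ (k ℕ.+ m)
  f = suc (k ℕ.+ m) !
  b b′ K M : ℚ
  b  = betaSum m k
  b′ = betaSum (suc m) k
  K  = ℕ→ℚ k
  M  = ℕ→ℚ m
  b′-factorial : b′ * (ℕ→ℚ s * ℕ→ℚ f) ≡ ℕ→ℚ (k !) * ℕ→ℚ (suc m !)
  b′-factorial = begin
    b′ * (ℕ→ℚ s * ℕ→ℚ f)                   ≡⟨ cong (b′ *_) (sym (ℕ→ℚ-* s f)) ⟩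
    b′ * ℕ→ℚ (suc (suc (k ℕ.+ m)) !)       ≡⟨ cong (λ j → b′ * ℕ→ℚ (suc j !)) (sym (ℕP.+-suc k m)) ⟩
    b′ * ℕ→ℚ (suc (k ℕ.+ suc m) !)         ≡⟨ betaSum-factorial (suc m) k ⟩
    ℕ→ℚ (k !) * ℕ→ℚ (suc m !)              ∎

betaSum-sucʳ : ∀ m k → betaSum m (suc k) * ℕ→ℚ (2 ℕ.+ (k ℕ.+ m)) ≡ ℕ→ℚ (suc k) * betaSum m k
betaSum-sucʳ m k = *-cancelʳ-ℕ→ℚ f {{ℕP._!≢0 (suc (k ℕ.+ m))}} (begin
  betaSum m (suc k) * ℕ→ℚ s * ℕ→ℚ f
    ≡⟨ trans (*-assoc (betaSum m (suc k)) (ℕ→ℚ s) (ℕ→ℚ f)) (cong (betaSum m (suc k) *_) (sym (ℕ→ℚ-* s f))) ⟩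
  betaSum m (suc k) * ℕ→ℚ (suc (suc k ℕ.+ m) !)
    ≡⟨ betaSum-factorial m (suc k) ⟩
  ℕ→ℚ (suc k !) * ℕ→ℚ (m !)
    ≡⟨ cong (_* ℕ→ℚ (m !)) (ℕ→ℚ-* (suc k) (k !)) ⟩
  ℕ→ℚ (suc k) * ℕ→ℚ (k !) * ℕ→ℚ (m !)
    ≡⟨ trans (*-assoc (ℕ→ℚ (suc k)) _ _) (cong (ℕ→ℚ (suc k) *_) (sym (betaSum-factorial m k))) ⟩
  ℕ→ℚ (suc k) * (betaSum m k * ℕ→ℚ f)
    ≡⟨ sym (*-assoc (ℕ→ℚ (suc k)) (betaSum m k) (ℕ→ℚ f)) ⟩
  ℕ→ℚ (suc k) * betaSum m k * ℕ→ℚ f ∎)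
  where
  s f : ℕ
  s = 2 ℕ.+ (k ℕ.+ m)
  f = suc (k ℕ.+ m) !

betaSum-sucˡ : ∀ m k → betaSum (suc m) k * ℕ→ℚ (2 ℕ.+ (k ℕ.+ m)) ≡ ℕ→ℚ (suc m) * betaSum m k
betaSum-sucˡ m k = begin
  b′ * S
    ≡⟨ cong (_* S) (solve 2 (λ b b′ → b′ := b :- (b :- b′)) refl b b′) ⟩
  (b - (b - b′)) * S
    ≡⟨ cong (λ x → (b - x) * S) (sym (betaSum-pascal m k)) ⟩
  (b - betaSum m (suc k)) * S
    ≡⟨ solve 3 (λ b b₁ S → (b :- b₁) :* S := b :* S :- b₁ :* S) refl b (betaSum m (suc k)) S ⟩
  b * S - betaSum m (suc k) * S
    ≡⟨ cong (_-_ (b * S)) (betaSum-sucʳ m k) ⟩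
  b * S - ℕ→ℚ (suc k) * b
    ≡⟨ cong₂ (λ x y → b * x - y * b) (trans (ℕ→ℚ-+ 2 (k ℕ.+ m)) (cong (ℕ→ℚ 2 +_) (ℕ→ℚ-+ k m))) (ℕ→ℚ-suc k) ⟩
  b * (ℕ→ℚ 2 + (K + M)) - (1ℚ + K) * b
    ≡⟨ solve 3 (λ b K M → b :* (con (ℕ→ℚ 2) :+ (K :+ M)) :- (con 1ℚ :+ K) :* b := (con 1ℚ :+ M) :* b) refl b K M ⟩
  (1ℚ + M) * b
    ≡⟨ cong (_* b) (sym (ℕ→ℚ-suc m)) ⟩
  ℕ→ℚ (suc m) * b ∎
  where
  b b′ S K M : ℚ
  b  = betaSum m k
  b′ = betaSum (suc m) k
  S  = ℕ→ℚ (2 ℕ.+ (k ℕ.+ m))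
  K  = ℕ→ℚ k
  M  = ℕ→ℚ m

[k+d]Ck*k!*d!≡[k+d]! : ∀ k d → ((k ℕ.+ d) C k) ℕ.* (k ! ℕ.* d !) ≡ (k ℕ.+ d) !
[k+d]Ck*k!*d!≡[k+d]! k d = subst (λ j → ((k ℕ.+ d) C k) ℕ.* (k ! ℕ.* j !) ≡ (k ℕ.+ d) !) (ℕP.m+n∸m≡n k d)
  (trans (cong (ℕ._* (k ! ℕ.* (k ℕ.+ d ∸ k) !)) (nCk≡n!/k![n-k]! k≤k+d)) (m/n*n≡m (k![n∸k]!∣n! k≤k+d)))
  where
  k≤k+d = ℕP.m≤m+n k d
  instance _ = k ℕP.!* (k ℕ.+ d ∸ k) !≢0

recipℕ-[k+d]Ck : ∀ k d → recipℕ ((k ℕ.+ d) C k) ≡ ℕ→ℚ (suc (k ℕ.+ d)) * betaSum d k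
recipℕ-[k+d]Ck k d = sym (recipℕ-unique c {{c≢0}} (*-cancelʳ-ℕ→ℚ (k ! ℕ.* d !) {{k ℕP.!* d !≢0}} (begin
  x * ℕ→ℚ c * ℕ→ℚ (k ! ℕ.* d !)
    ≡⟨ trans (*-assoc x (ℕ→ℚ c) _) (cong (x *_) (trans (sym (ℕ→ℚ-* c _)) (cong ℕ→ℚ ([k+d]Ck*k!*d!≡[k+d]! k d)))) ⟩
  ℕ→ℚ (suc (k ℕ.+ d)) * betaSum d k * ℕ→ℚ ((k ℕ.+ d) !)
    ≡⟨ solve 3 (λ s b f → s :* b :* f := b :* (s :* f)) refl (ℕ→ℚ (suc (k ℕ.+ d))) (betaSum d k) (ℕ→ℚ ((k ℕ.+ d) !)) ⟩
  betaSum d k * (ℕ→ℚ (suc (k ℕ.+ d)) * ℕ→ℚ ((k ℕ.+ d) !))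
    ≡⟨ cong (betaSum d k *_) (sym (ℕ→ℚ-* (suc (k ℕ.+ d)) ((k ℕ.+ d) !))) ⟩
  betaSum d k * ℕ→ℚ (suc (k ℕ.+ d) !)
    ≡⟨ betaSum-factorial d k ⟩
  ℕ→ℚ (k !) * ℕ→ℚ (d !)
    ≡⟨ sym (trans (*-identityˡ (ℕ→ℚ (k ! ℕ.* d !))) (ℕ→ℚ-* (k !) (d !))) ⟩
  1ℚ * ℕ→ℚ (k ! ℕ.* d !) ∎)))
  where
  c : ℕ
  c = (k ℕ.+ d) C k
  x : ℚ
  x = ℕ→ℚ (suc (k ℕ.+ d)) * betaSum d k
  c≢0 : NonZero c
  c≢0 = ℕP.m*n≢0⇒m≢0 c {{subst NonZero (sym ([k+d]Ck*k!*d!≡[k+d]! k d)) ((k ℕ.+ d) ℕP.!≢0)}}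

recipℕ-[1+k+d]Ck : ∀ k d → recipℕ (suc (k ℕ.+ d) C k) ≡ ℕ→ℚ (suc d) * betaSum d k
recipℕ-[1+k+d]Ck k d = begin
  recipℕ (suc (k ℕ.+ d) C k)
    ≡⟨ cong (λ j → recipℕ (j C k)) (sym (ℕP.+-suc k d)) ⟩
  recipℕ ((k ℕ.+ suc d) C k)
    ≡⟨ recipℕ-[k+d]Ck k (suc d) ⟩
  ℕ→ℚ (suc (k ℕ.+ suc d)) * betaSum (suc d) k
    ≡⟨ cong (λ j → ℕ→ℚ (suc j) * betaSum (suc d) k) (ℕP.+-suc k d) ⟩
  ℕ→ℚ (2 ℕ.+ (k ℕ.+ d)) * betaSum (suc d) k
    ≡⟨ trans (*-comm (ℕ→ℚ (2 ℕ.+ (k ℕ.+ d))) (betaSum (suc d) k)) (betaSum-sucˡ d k) ⟩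
  ℕ→ℚ (suc d) * betaSum d k ∎

recipℕ-[1+k+d]C[1+k] : ∀ k d → recipℕ (suc (k ℕ.+ d) C suc k) ≡ ℕ→ℚ (suc k) * betaSum d k
recipℕ-[1+k+d]C[1+k] k d =
  trans (recipℕ-[k+d]Ck (suc k) d) (trans (*-comm (ℕ→ℚ (2 ℕ.+ (k ℕ.+ d))) (betaSum d (suc k))) (betaSum-sucʳ d k))

invBinomSq : ℕ → ℕ → ℚ
invBinomSq n k = recipℕ (n C k) * recipℕ (n C k)

invBinomSq-betaSum : ∀ {n k} → k ≤ n →
  invBinomSq n k ≡ ℕ→ℚ (suc n) * ℕ→ℚ (suc n) * (betaSum (n ∸ k) k * betaSum (n ∸ k) k)
invBinomSq-betaSum {n} {k} k≤n with ℕP.m≤n⇒∃[o]m+o≡n k≤n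
... | d , refl = trans (square-of-product (ℕ→ℚ (suc (k ℕ.+ d))) (betaSum d k) (recipℕ-[k+d]Ck k d))
  (cong (λ j → ℕ→ℚ (suc (k ℕ.+ d)) * ℕ→ℚ (suc (k ℕ.+ d)) * (betaSum j k * betaSum j k)) (sym (ℕP.m+n∸m≡n k d)))

invBinomSq-sum-betaSum : ∀ n →
  Σ[0… n ] (invBinomSq n) ≡ ℕ→ℚ (suc n) * ℕ→ℚ (suc n) * Σ[0… n ] (λ k → betaSum (n ∸ k) k * betaSum (n ∸ k) k)
invBinomSq-sum-betaSum n = trans (Σ-cong n invBinomSq-betaSum) (Σ-*ˡ n (ℕ→ℚ (suc n) * ℕ→ℚ (suc n)) _)

invBinomSq-diagonal : ∀ n → invBinomSq n n ≡ 1ℚ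
invBinomSq-diagonal n = cong (λ c → recipℕ c * recipℕ c) (nCn≡1 n)

αᵃ βᵃ : ℚ → ℚ
αᵃ N = (N + ℕ→ℚ 2) * (N + ℕ→ℚ 2) * (N + ℕ→ℚ 2)
βᵃ N = ℕ→ℚ 2 * ((N + 1ℚ) * (N + 1ℚ)) * (ℕ→ℚ 2 * N + ℕ→ℚ 5)

-- The telescoping bracket is split into Hᵃ and Gᵃ because Hᵃ at k equals Gᵃ at k + 1
-- only for k < n: at k = n the factor (n + 1 - k)² of Gᵃ vanishes against 1 / C(n, n + 1),
-- which recipℕ turns into the junk value 0.
Hᵃ Gᵃ : ℚ → ℚ → ℚ
Hᵃ N K = (ℕ→ℚ 3 * N + ℕ→ℚ 4 - ℕ→ℚ 2 * K) * ((K + 1ℚ) * (K + 1ℚ))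
Gᵃ N K = (N + 1ℚ - K) * (N + 1ℚ - K) * (ℕ→ℚ 3 * N + ℕ→ℚ 6 - ℕ→ℚ 2 * K)

invBinomSq-telescoping : ∀ {n k} → k ≤ n → let N = ℕ→ℚ n; K = ℕ→ℚ k in
  αᵃ N * invBinomSq n k - βᵃ N * invBinomSq (suc n) k ≡ Hᵃ N K * invBinomSq n k - Gᵃ N K * invBinomSq n k
invBinomSq-telescoping {n} {k} k≤n with ℕP.m≤n⇒∃[o]m+o≡n k≤n
... | d , refl = begin
  αᵃ N * a - βᵃ N * a′
    ≡⟨ cong₂ (λ x y → αᵃ N * x - βᵃ N * y) a≡ a′≡ ⟩
  αᵃ N * ((1ℚ + N) * (1ℚ + N) * X) - βᵃ N * ((1ℚ + D) * (1ℚ + D) * X)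
    ≡⟨ identity K D X (ℕ→ℚ-+ k d) ⟩
  Hᵃ N K * ((1ℚ + N) * (1ℚ + N) * X) - Gᵃ N K * ((1ℚ + N) * (1ℚ + N) * X)
    ≡⟨ cong (λ x → Hᵃ N K * x - Gᵃ N K * x) (sym a≡) ⟩
  Hᵃ N K * a - Gᵃ N K * a ∎
  where
  identity : ∀ {N} K D X → N ≡ K + D → let a = (1ℚ + N) * (1ℚ + N) * X in
    αᵃ N * a - βᵃ N * ((1ℚ + D) * (1ℚ + D) * X) ≡ Hᵃ N K * a - Gᵃ N K * a
  identity K D X refl = solve 3 (λ K D X →
    let N = K :+ D
        a = (con 1ℚ :+ N) :* (con 1ℚ :+ N) :* X
    in (N :+ con (ℕ→ℚ 2)) :* (N :+ con (ℕ→ℚ 2)) :* (N :+ con (ℕ→ℚ 2)) :* a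
         :- con (ℕ→ℚ 2) :* ((N :+ con 1ℚ) :* (N :+ con 1ℚ)) :* (con (ℕ→ℚ 2) :* N :+ con (ℕ→ℚ 5))
            :* ((con 1ℚ :+ D) :* (con 1ℚ :+ D) :* X)
       := (con (ℕ→ℚ 3) :* N :+ con (ℕ→ℚ 4) :- con (ℕ→ℚ 2) :* K) :* ((K :+ con 1ℚ) :* (K :+ con 1ℚ)) :* a
         :- (N :+ con 1ℚ :- K) :* (N :+ con 1ℚ :- K) :* (con (ℕ→ℚ 3) :* N :+ con (ℕ→ℚ 6) :- con (ℕ→ℚ 2) :* K) :* a)
    refl K D X

  N K D X a a′ : ℚ
  N  = ℕ→ℚ (k ℕ.+ d)
  K  = ℕ→ℚ k
  D  = ℕ→ℚ d
  X  = betaSum d k * betaSum d k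
  a  = invBinomSq (k ℕ.+ d) k
  a′ = invBinomSq (suc (k ℕ.+ d)) k
  a≡ : a ≡ (1ℚ + N) * (1ℚ + N) * X
  a≡ = square-of-product (1ℚ + N) (betaSum d k) (trans (recipℕ-[k+d]Ck k d) (cong (_* betaSum d k) (ℕ→ℚ-suc (k ℕ.+ d))))
  a′≡ : a′ ≡ (1ℚ + D) * (1ℚ + D) * X
  a′≡ = square-of-product (1ℚ + D) (betaSum d k) (trans (recipℕ-[1+k+d]Ck k d) (cong (_* betaSum d k) (ℕ→ℚ-suc d)))

invBinomSq-shift : ∀ {n k} → k < n →
  Hᵃ (ℕ→ℚ n) (ℕ→ℚ k) * invBinomSq n k ≡ Gᵃ (ℕ→ℚ n) (ℕ→ℚ (suc k)) * invBinomSq n (suc k)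
invBinomSq-shift {n} {k} k<n with ℕP.m≤n⇒∃[o]m+o≡n k<n
... | d , refl = begin
  Hᵃ N K * invBinomSq (suc (k ℕ.+ d)) k
    ≡⟨ cong (Hᵃ N K *_) (square-of-product (1ℚ + D) φ (trans (recipℕ-[1+k+d]Ck k d) (cong (_* φ) (ℕ→ℚ-suc d)))) ⟩
  Hᵃ N K * ((1ℚ + D) * (1ℚ + D) * (φ * φ))
    ≡⟨ identity K D (φ * φ) (trans (ℕ→ℚ-suc (k ℕ.+ d)) (cong (1ℚ +_) (ℕ→ℚ-+ k d))) (ℕ→ℚ-suc k) ⟩
  Gᵃ N K₁ * (K₁ * K₁ * (φ * φ))
    ≡⟨ cong (Gᵃ N K₁ *_) (sym (square-of-product K₁ φ (recipℕ-[1+k+d]C[1+k] k d))) ⟩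
  Gᵃ N K₁ * invBinomSq (suc (k ℕ.+ d)) (suc k) ∎
  where
  identity : ∀ {N K₁} K D X → N ≡ 1ℚ + (K + D) → K₁ ≡ 1ℚ + K →
    Hᵃ N K * ((1ℚ + D) * (1ℚ + D) * X) ≡ Gᵃ N K₁ * (K₁ * K₁ * X)
  identity K D X refl refl = solve 3 (λ K D X →
    let N = con 1ℚ :+ (K :+ D)
        K₁ = con 1ℚ :+ K
    in (con (ℕ→ℚ 3) :* N :+ con (ℕ→ℚ 4) :- con (ℕ→ℚ 2) :* K) :* ((K :+ con 1ℚ) :* (K :+ con 1ℚ))
         :* ((con 1ℚ :+ D) :* (con 1ℚ :+ D) :* X)
       := (N :+ con 1ℚ :- K₁) :* (N :+ con 1ℚ :- K₁) :* (con (ℕ→ℚ 3) :* N :+ con (ℕ→ℚ 6) :- con (ℕ→ℚ 2) :* K₁)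
         :* (K₁ :* K₁ :* X))
    refl K D X

  N K K₁ D φ : ℚ
  N  = ℕ→ℚ (suc (k ℕ.+ d))
  K  = ℕ→ℚ k
  K₁ = ℕ→ℚ (suc k)
  D  = ℕ→ℚ d
  φ  = betaSum d k

invBinomSq-recurrence : ∀ n → let N = ℕ→ℚ n in
  αᵃ N * Σ[0… n ] (invBinomSq n) + ℕ→ℚ 6 * ((N + 1ℚ) * (N + 1ℚ)) * (N + ℕ→ℚ 2)
    ≡ βᵃ N * Σ[0… suc n ] (invBinomSq (suc n))
invBinomSq-recurrence n = begin
  αᵃ N * A + c
    ≡⟨ solve 5 (λ α β A Σ′ c → α :* A :+ c := (α :* A :- β :* Σ′) :+ β :* Σ′ :+ c) refl (αᵃ N) (βᵃ N) A Σ′ c ⟩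
  (αᵃ N * A - βᵃ N * Σ′) + βᵃ N * Σ′ + c
    ≡⟨ cong (λ t → t + βᵃ N * Σ′ + c)
         (creative-telescoping n (αᵃ N) (βᵃ N) (invBinomSq n) (invBinomSq (suc n)) H G
           invBinomSq-telescoping invBinomSq-shift) ⟩
  (Hᵃ N N * invBinomSq n n - Gᵃ N 0ℚ * 1ℚ) + βᵃ N * Σ′ + c
    ≡⟨ cong (λ t → (Hᵃ N N * t - Gᵃ N 0ℚ * 1ℚ) + βᵃ N * Σ′ + c) (invBinomSq-diagonal n) ⟩
  (Hᵃ N N * 1ℚ - Gᵃ N 0ℚ * 1ℚ) + βᵃ N * Σ′ + c
    ≡⟨ solve 2 (λ N Σ′ →
         let two = con (ℕ→ℚ 2)
             N+1² = (N :+ con 1ℚ) :* (N :+ con 1ℚ)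
             β = two :* N+1² :* (two :* N :+ con (ℕ→ℚ 5))
         in ((con (ℕ→ℚ 3) :* N :+ con (ℕ→ℚ 4) :- two :* N) :* N+1² :* con 1ℚ
              :- (N :+ con 1ℚ :- con 0ℚ) :* (N :+ con 1ℚ :- con 0ℚ)
                 :* (con (ℕ→ℚ 3) :* N :+ con (ℕ→ℚ 6) :- two :* con 0ℚ) :* con 1ℚ)
            :+ β :* Σ′ :+ con (ℕ→ℚ 6) :* N+1² :* (N :+ two)
          := β :* (Σ′ :+ con 1ℚ))
       refl N Σ′ ⟩
  βᵃ N * (Σ′ + 1ℚ)
    ≡⟨ cong (λ t → βᵃ N * (Σ′ + t)) (sym (invBinomSq-diagonal (suc n))) ⟩
  βᵃ N * Σ[0… suc n ] (invBinomSq (suc n)) ∎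
  where
  N A Σ′ c : ℚ
  N  = ℕ→ℚ n
  A  = Σ[0… n ] (invBinomSq n)
  Σ′ = Σ[0… n ] (invBinomSq (suc n))
  c  = ℕ→ℚ 6 * ((N + 1ℚ) * (N + 1ℚ)) * (N + ℕ→ℚ 2)
  H G : ℕ → ℚ
  H k = Hᵃ N (ℕ→ℚ k) * invBinomSq n k
  G k = Gᵃ N (ℕ→ℚ k) * invBinomSq n k

weightedBeta : ℕ → ℕ → ℚ
weightedBeta n k = recipℕ (suc (n ∸ k)) * betaSum (suc n) k

weightedBeta-unweight : ∀ n k → weightedBeta n k * ℕ→ℚ (suc (n ∸ k)) ≡ betaSum (suc n) k
weightedBeta-unweight n k = begin
  r * b * q    ≡⟨ solve 3 (λ r b q → r :* b :* q := (r :* q) :* b) refl r b q ⟩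
  (r * q) * b  ≡⟨ cong (_* b) (recipℕ-inverse (suc (n ∸ k))) ⟩
  1ℚ * b       ≡⟨ *-identityˡ b ⟩
  b            ∎
  where
  r b q : ℚ
  r = recipℕ (suc (n ∸ k))
  b = betaSum (suc n) k
  q = ℕ→ℚ (suc (n ∸ k))

weightedBeta-sucˡ : ∀ n k →
  weightedBeta (suc n) k * ℕ→ℚ (suc (suc n ∸ k)) * ℕ→ℚ (2 ℕ.+ (k ℕ.+ suc n))
    ≡ ℕ→ℚ (2 ℕ.+ n) * (weightedBeta n k * ℕ→ℚ (suc (n ∸ k)))
weightedBeta-sucˡ n k = begin
  weightedBeta (suc n) k * ℕ→ℚ (suc (suc n ∸ k)) * ℕ→ℚ (2 ℕ.+ (k ℕ.+ suc n))
    ≡⟨ cong (_* ℕ→ℚ (2 ℕ.+ (k ℕ.+ suc n))) (weightedBeta-unweight (suc n) k) ⟩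
  betaSum (2 ℕ.+ n) k * ℕ→ℚ (2 ℕ.+ (k ℕ.+ suc n))
    ≡⟨ betaSum-sucˡ (suc n) k ⟩
  ℕ→ℚ (2 ℕ.+ n) * betaSum (suc n) k
    ≡⟨ cong (ℕ→ℚ (2 ℕ.+ n) *_) (sym (weightedBeta-unweight n k)) ⟩
  ℕ→ℚ (2 ℕ.+ n) * (weightedBeta n k * ℕ→ℚ (suc (n ∸ k))) ∎

weightedBeta-sucʳ : ∀ n k →
  weightedBeta (suc n) (suc k) * ℕ→ℚ (suc (n ∸ k)) * ℕ→ℚ (2 ℕ.+ (k ℕ.+ (2 ℕ.+ n)))
    ≡ ℕ→ℚ (suc k) * (weightedBeta (suc n) k * ℕ→ℚ (suc (suc n ∸ k)))
weightedBeta-sucʳ n k = begin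
  weightedBeta (suc n) (suc k) * ℕ→ℚ (suc (n ∸ k)) * ℕ→ℚ (2 ℕ.+ (k ℕ.+ (2 ℕ.+ n)))
    ≡⟨ cong (_* ℕ→ℚ (2 ℕ.+ (k ℕ.+ (2 ℕ.+ n)))) (weightedBeta-unweight (suc n) (suc k)) ⟩
  betaSum (2 ℕ.+ n) (suc k) * ℕ→ℚ (2 ℕ.+ (k ℕ.+ (2 ℕ.+ n)))
    ≡⟨ betaSum-sucʳ (2 ℕ.+ n) k ⟩
  ℕ→ℚ (suc k) * betaSum (2 ℕ.+ n) k
    ≡⟨ cong (ℕ→ℚ (suc k) *_) (sym (weightedBeta-unweight (suc n) k)) ⟩
  ℕ→ℚ (suc k) * (weightedBeta (suc n) k * ℕ→ℚ (suc (suc n ∸ k))) ∎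

αᵇ βᵇ : ℚ → ℚ
αᵇ N = (N + ℕ→ℚ 2) * (N + ℕ→ℚ 2)
βᵇ N = ℕ→ℚ 2 * (ℕ→ℚ 2 * N + ℕ→ℚ 5) * (N + ℕ→ℚ 2)

Γᵇ : ℚ → ℚ → ℚ
Γᵇ N K = (N + K + ℕ→ℚ 3) * (ℕ→ℚ 3 * N + ℕ→ℚ 6 - K)

-- Multiplying by the denominators n + 2, n - k + 1 (twice) and n + k + 4 of the
-- contiguity relations weightedBeta-sucˡ/sucʳ makes the certificate identity polynomial.
Γᵇ-certificate : ∀ {N K₁} K D x y z → N ≡ K + D → K₁ ≡ 1ℚ + K →
  y * (ℕ→ℚ 2 + D) * (ℕ→ℚ 2 + (K + (1ℚ + N))) ≡ (ℕ→ℚ 2 + N) * (x * (1ℚ + D)) →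
  z * (1ℚ + D) * (ℕ→ℚ 2 + (K + (ℕ→ℚ 2 + N))) ≡ K₁ * (y * (ℕ→ℚ 2 + D)) →
  let P = (ℕ→ℚ 2 + N) * (1ℚ + D) * (1ℚ + D) * (ℕ→ℚ 2 + (K + (ℕ→ℚ 2 + N))) in
  (αᵇ N * x - βᵇ N * y) * P ≡ (Γᵇ N K₁ * z - Γᵇ N K * y) * P
Γᵇ-certificate {N} {K₁} K D x y z refl refl r₁ r₂ = begin
  (α * x - β * y) * (F₂ * A₁ * A₁ * S₄)
    ≡⟨ solve 7 (λ α β x y F₂ A₁ S₄ → (α :* x :- β :* y) :* (F₂ :* A₁ :* A₁ :* S₄)
                 := α :* (F₂ :* (x :* A₁)) :* (A₁ :* S₄) :- β :* y :* (F₂ :* A₁ :* A₁ :* S₄))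
         refl α β x y F₂ A₁ S₄ ⟩
  α * (F₂ * (x * A₁)) * (A₁ * S₄) - β * y * P
    ≡⟨ cong (λ t → α * t * (A₁ * S₄) - β * y * P) (sym r₁) ⟩
  α * (y * A₂ * S₃) * (A₁ * S₄) - β * y * P
    ≡⟨ solve 3 (λ K D y →
         let two = con (ℕ→ℚ 2)
             N = K :+ D
             F₂ = two :+ N
             A₁ = con 1ℚ :+ D
             A₂ = two :+ D
             S₃ = two :+ (K :+ (con 1ℚ :+ N))
             S₄ = two :+ (K :+ (two :+ N))
             K₁ = con 1ℚ :+ K
             P = F₂ :* A₁ :* A₁ :* S₄
             Γ = λ J → (N :+ J :+ con (ℕ→ℚ 3)) :* (con (ℕ→ℚ 3) :* N :+ con (ℕ→ℚ 6) :- J)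
         in (N :+ two) :* (N :+ two) :* (y :* A₂ :* S₃) :* (A₁ :* S₄)
              :- two :* (two :* N :+ con (ℕ→ℚ 5)) :* (N :+ two) :* y :* P
            := Γ K₁ :* (K₁ :* (y :* A₂)) :* (F₂ :* A₁) :- Γ K :* y :* P)
         refl K D y ⟩
  Γᵇ N K₁ * (K₁ * (y * A₂)) * (F₂ * A₁) - Γᵇ N K * y * P
    ≡⟨ cong (λ t → Γᵇ N K₁ * t * (F₂ * A₁) - Γᵇ N K * y * P) (sym r₂) ⟩
  Γᵇ N K₁ * (z * A₁ * S₄) * (F₂ * A₁) - Γᵇ N K * y * P
    ≡⟨ solve 7 (λ c₁ c₀ z y F₂ A₁ S₄ → c₁ :* (z :* A₁ :* S₄) :* (F₂ :* A₁) :- c₀ :* y :* (F₂ :* A₁ :* A₁ :* S₄)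
                 := (c₁ :* z :- c₀ :* y) :* (F₂ :* A₁ :* A₁ :* S₄))
         refl (Γᵇ N K₁) (Γᵇ N K) z y F₂ A₁ S₄ ⟩
  (Γᵇ N K₁ * z - Γᵇ N K * y) * P ∎
  where
  α β F₂ A₁ A₂ S₃ S₄ P : ℚ
  α  = αᵇ N
  β  = βᵇ N
  F₂ = ℕ→ℚ 2 + N
  A₁ = 1ℚ + D
  A₂ = ℕ→ℚ 2 + D
  S₃ = ℕ→ℚ 2 + (K + (1ℚ + N))
  S₄ = ℕ→ℚ 2 + (K + (ℕ→ℚ 2 + N))
  P  = F₂ * A₁ * A₁ * S₄

weightedBeta-telescoping : ∀ {n k} → k ≤ n → let N = ℕ→ℚ n; K = ℕ→ℚ k in
  αᵇ N * weightedBeta n k - βᵇ N * weightedBeta (suc n) k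
    ≡ Γᵇ N (ℕ→ℚ (suc k)) * weightedBeta (suc n) (suc k) - Γᵇ N K * weightedBeta (suc n) k
weightedBeta-telescoping {n} {k} k≤n = *-cancelʳ-ℕ→ℚ m
  (subst (λ p → (αᵇ N * x - βᵇ N * y) * p ≡ (Γᵇ N K₁ * z - Γᵇ N K * y) * p) (sym ℕ→ℚ-m)
    (Γᵇ-certificate K D x y z N≡K+D (ℕ→ℚ-suc k) r₁ r₂))
  where
  N K K₁ D x y z : ℚ
  N  = ℕ→ℚ n
  K  = ℕ→ℚ k
  K₁ = ℕ→ℚ (suc k)
  D  = ℕ→ℚ (n ∸ k)
  x  = weightedBeta n k
  y  = weightedBeta (suc n) k
  z  = weightedBeta (suc n) (suc k)

  N≡K+D : N ≡ K + D
  N≡K+D = trans (cong ℕ→ℚ (sym (ℕP.m+[n∸m]≡n k≤n))) (ℕ→ℚ-+ k (n ∸ k))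
  1+D : ℕ→ℚ (suc (n ∸ k)) ≡ 1ℚ + D
  1+D = ℕ→ℚ-suc (n ∸ k)
  2+D : ℕ→ℚ (suc (suc n ∸ k)) ≡ ℕ→ℚ 2 + D
  2+D = trans (cong (ℕ→ℚ ∘ suc) (ℕP.+-∸-assoc 1 k≤n)) (ℕ→ℚ-+ 2 (n ∸ k))
  2+N : ℕ→ℚ (2 ℕ.+ n) ≡ ℕ→ℚ 2 + N
  2+N = ℕ→ℚ-+ 2 n
  S₃≡ : ℕ→ℚ (2 ℕ.+ (k ℕ.+ suc n)) ≡ ℕ→ℚ 2 + (K + (1ℚ + N))
  S₃≡ = trans (ℕ→ℚ-+ 2 (k ℕ.+ suc n)) (cong (ℕ→ℚ 2 +_) (trans (ℕ→ℚ-+ k (suc n)) (cong (K +_) (ℕ→ℚ-suc n))))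
  S₄≡ : ℕ→ℚ (2 ℕ.+ (k ℕ.+ (2 ℕ.+ n))) ≡ ℕ→ℚ 2 + (K + (ℕ→ℚ 2 + N))
  S₄≡ = trans (ℕ→ℚ-+ 2 (k ℕ.+ (2 ℕ.+ n))) (cong (ℕ→ℚ 2 +_) (trans (ℕ→ℚ-+ k (2 ℕ.+ n)) (cong (K +_) 2+N)))

  r₁ : y * (ℕ→ℚ 2 + D) * (ℕ→ℚ 2 + (K + (1ℚ + N))) ≡ (ℕ→ℚ 2 + N) * (x * (1ℚ + D))
  r₁ = trans (sym (cong₂ (λ u v → y * u * v) 2+D S₃≡))
      (trans (weightedBeta-sucˡ n k) (cong₂ (λ u v → u * (x * v)) 2+N 1+D))
  r₂ : z * (1ℚ + D) * (ℕ→ℚ 2 + (K + (ℕ→ℚ 2 + N))) ≡ K₁ * (y * (ℕ→ℚ 2 + D))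
  r₂ = trans (sym (cong₂ (λ u v → z * u * v) 1+D S₄≡))
      (trans (weightedBeta-sucʳ n k) (cong (λ u → K₁ * (y * u)) 2+D))

  f₂ a₁ s₄ m : ℕ
  f₂ = 2 ℕ.+ n
  a₁ = suc (n ∸ k)
  s₄ = 2 ℕ.+ (k ℕ.+ (2 ℕ.+ n))
  m  = f₂ ℕ.* a₁ ℕ.* a₁ ℕ.* s₄
  ℕ→ℚ-m : ℕ→ℚ m ≡ (ℕ→ℚ 2 + N) * (1ℚ + D) * (1ℚ + D) * (ℕ→ℚ 2 + (K + (ℕ→ℚ 2 + N)))
  ℕ→ℚ-m = trans (ℕ→ℚ-* (f₂ ℕ.* a₁ ℕ.* a₁) s₄) (cong₂ _*_
    (trans (ℕ→ℚ-* (f₂ ℕ.* a₁) a₁) (cong₂ _*_ (trans (ℕ→ℚ-* f₂ a₁) (cong₂ _*_ 2+N 1+D)) 1+D)) S₄≡)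

weightedBeta-initial : ∀ n → Γᵇ (ℕ→ℚ n) 0ℚ * weightedBeta (suc n) 0 ≡ ℕ→ℚ 3
weightedBeta-initial n = begin
  Γᵇ N 0ℚ * (r₂ * (1ℚ * recipℕ (3 ℕ.+ (n ℕ.+ 0)) * 1ℚ))
    ≡⟨ cong (λ j → Γᵇ N 0ℚ * (r₂ * (1ℚ * recipℕ (3 ℕ.+ j) * 1ℚ))) (ℕP.+-identityʳ n) ⟩
  Γᵇ N 0ℚ * (r₂ * (1ℚ * r₃ * 1ℚ))
    ≡⟨ solve 3 (λ N r₂ r₃ →
         (N :+ con 0ℚ :+ con (ℕ→ℚ 3)) :* (con (ℕ→ℚ 3) :* N :+ con (ℕ→ℚ 6) :- con 0ℚ) :* (r₂ :* (con 1ℚ :* r₃ :* con 1ℚ))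
         := con (ℕ→ℚ 3) :* ((r₂ :* (con (ℕ→ℚ 2) :+ N)) :* (r₃ :* (con (ℕ→ℚ 3) :+ N))))
       refl N r₂ r₃ ⟩
  ℕ→ℚ 3 * ((r₂ * (ℕ→ℚ 2 + N)) * (r₃ * (ℕ→ℚ 3 + N)))
    ≡⟨ cong₂ (λ a b → ℕ→ℚ 3 * ((r₂ * a) * (r₃ * b))) (sym (ℕ→ℚ-+ 2 n)) (sym (ℕ→ℚ-+ 3 n)) ⟩
  ℕ→ℚ 3 * ((r₂ * ℕ→ℚ (2 ℕ.+ n)) * (r₃ * ℕ→ℚ (3 ℕ.+ n)))
    ≡⟨ cong₂ (λ a b → ℕ→ℚ 3 * (a * b)) (recipℕ-inverse (2 ℕ.+ n)) (recipℕ-inverse (3 ℕ.+ n)) ⟩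
  ℕ→ℚ 3 * (1ℚ * 1ℚ) ∎
  where
  N r₂ r₃ : ℚ
  N  = ℕ→ℚ n
  r₂ = recipℕ (2 ℕ.+ n)
  r₃ = recipℕ (3 ℕ.+ n)

weightedBeta-recurrence : ∀ n → let N = ℕ→ℚ n in
  αᵇ N * Σ[0… n ] (weightedBeta n) + ℕ→ℚ 3 ≡ βᵇ N * Σ[0… suc n ] (weightedBeta (suc n))
weightedBeta-recurrence n = begin
  αᵇ N * B + ℕ→ℚ 3
    ≡⟨ solve 5 (λ α β B Σ′ c → α :* B :+ c := (α :* B :- β :* Σ′) :+ β :* Σ′ :+ c) refl (αᵇ N) (βᵇ N) B Σ′ (ℕ→ℚ 3) ⟩
  (αᵇ N * B - βᵇ N * Σ′) + βᵇ N * Σ′ + ℕ→ℚ 3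
    ≡⟨ cong (λ t → t + βᵇ N * Σ′ + ℕ→ℚ 3)
         (creative-telescoping n (αᵇ N) (βᵇ N) (weightedBeta n) (weightedBeta (suc n)) H G
           weightedBeta-telescoping (λ _ → refl)) ⟩
  (Γᵇ N (ℕ→ℚ (suc n)) * w - Γᵇ N 0ℚ * weightedBeta (suc n) 0) + βᵇ N * Σ′ + ℕ→ℚ 3
    ≡⟨ cong₂ (λ J g → (Γᵇ N J * w - g) + βᵇ N * Σ′ + ℕ→ℚ 3) (ℕ→ℚ-suc n) (weightedBeta-initial n) ⟩
  (Γᵇ N (1ℚ + N) * w - ℕ→ℚ 3) + βᵇ N * Σ′ + ℕ→ℚ 3
    ≡⟨ solve 3 (λ N w Σ′ →
         let two = con (ℕ→ℚ 2)
             β = two :* (two :* N :+ con (ℕ→ℚ 5)) :* (N :+ two)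
         in ((N :+ (con 1ℚ :+ N) :+ con (ℕ→ℚ 3)) :* (con (ℕ→ℚ 3) :* N :+ con (ℕ→ℚ 6) :- (con 1ℚ :+ N)) :* w
              :- con (ℕ→ℚ 3)) :+ β :* Σ′ :+ con (ℕ→ℚ 3)
            := β :* (Σ′ :+ w))
       refl N w Σ′ ⟩
  βᵇ N * (Σ′ + w) ∎
  where
  N B Σ′ w : ℚ
  N  = ℕ→ℚ n
  B  = Σ[0… n ] (weightedBeta n)
  Σ′ = Σ[0… n ] (weightedBeta (suc n))
  w  = weightedBeta (suc n) (suc n)
  H G : ℕ → ℚ
  H k = Γᵇ N (ℕ→ℚ (suc k)) * weightedBeta (suc n) (suc k)
  G k = Γᵇ N (ℕ→ℚ k) * weightedBeta (suc n) k

βᵃ-invertible : ∀ n → recipℕ (2 ℕ.* (suc n ℕ.* suc n) ℕ.* (5 ℕ.+ 2 ℕ.* n)) * βᵃ (ℕ→ℚ n) ≡ 1ℚ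
βᵃ-invertible n = subst (λ b → recipℕ m * b ≡ 1ℚ) ℕ→ℚ-m (recipℕ-inverse m)
  where
  m : ℕ
  m = 2 ℕ.* (suc n ℕ.* suc n) ℕ.* (5 ℕ.+ 2 ℕ.* n)
  n+1 : ℕ→ℚ (suc n) ≡ ℕ→ℚ n + 1ℚ
  n+1 = trans (ℕ→ℚ-suc n) (+-comm 1ℚ (ℕ→ℚ n))
  ℕ→ℚ-m : ℕ→ℚ m ≡ βᵃ (ℕ→ℚ n)
  ℕ→ℚ-m = trans (ℕ→ℚ-* (2 ℕ.* (suc n ℕ.* suc n)) (5 ℕ.+ 2 ℕ.* n)) (cong₂ _*_
    (trans (ℕ→ℚ-* 2 (suc n ℕ.* suc n)) (cong (ℕ→ℚ 2 *_) (trans (ℕ→ℚ-* (suc n) (suc n)) (cong₂ _*_ n+1 n+1))))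
    (trans (ℕ→ℚ-+ 5 (2 ℕ.* n)) (trans (+-comm (ℕ→ℚ 5) (ℕ→ℚ (2 ℕ.* n))) (cong (_+ ℕ→ℚ 5) (ℕ→ℚ-* 2 n)))))

invBinomSq-sum≡weightedBeta-sum : ∀ n →
  Σ[0… n ] (invBinomSq n) ≡ ℕ→ℚ 2 * (ℕ→ℚ (suc n) * ℕ→ℚ (suc n)) * Σ[0… n ] (weightedBeta n)
invBinomSq-sum≡weightedBeta-sum zero    = refl
invBinomSq-sum≡weightedBeta-sum (suc n) =
  *-cancelʳ-invertible (recipℕ (2 ℕ.* (suc n ℕ.* suc n) ℕ.* (5 ℕ.+ 2 ℕ.* n))) (βᵃ-invertible n) (begin
  A′ * βᵃ N
    ≡⟨ trans (*-comm A′ (βᵃ N)) (sym (invBinomSq-recurrence n)) ⟩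
  αᵃ N * Σ[0… n ] (invBinomSq n) + c
    ≡⟨ cong (λ t → αᵃ N * t + c) (trans (invBinomSq-sum≡weightedBeta-sum n) (cong (λ t → ℕ→ℚ 2 * (t * t) * B) n+1)) ⟩
  αᵃ N * (ℕ→ℚ 2 * ((N + 1ℚ) * (N + 1ℚ)) * B) + c
    ≡⟨ solve 2 (λ N B →
         let two = con (ℕ→ℚ 2) in
         (N :+ two) :* (N :+ two) :* (N :+ two) :* (two :* ((N :+ con 1ℚ) :* (N :+ con 1ℚ)) :* B)
           :+ con (ℕ→ℚ 6) :* ((N :+ con 1ℚ) :* (N :+ con 1ℚ)) :* (N :+ two)
         := two :* ((N :+ con 1ℚ) :* (N :+ con 1ℚ)) :* (N :+ two) :* ((N :+ two) :* (N :+ two) :* B :+ con (ℕ→ℚ 3)))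
       refl N B ⟩
  ℕ→ℚ 2 * ((N + 1ℚ) * (N + 1ℚ)) * (N + ℕ→ℚ 2) * (αᵇ N * B + ℕ→ℚ 3)
    ≡⟨ cong (ℕ→ℚ 2 * ((N + 1ℚ) * (N + 1ℚ)) * (N + ℕ→ℚ 2) *_) (weightedBeta-recurrence n) ⟩
  ℕ→ℚ 2 * ((N + 1ℚ) * (N + 1ℚ)) * (N + ℕ→ℚ 2) * (βᵇ N * B′)
    ≡⟨ solve 2 (λ N B′ →
         let two = con (ℕ→ℚ 2) in
         two :* ((N :+ con 1ℚ) :* (N :+ con 1ℚ)) :* (N :+ two) :* (two :* (two :* N :+ con (ℕ→ℚ 5)) :* (N :+ two) :* B′)
         := two :* ((N :+ two) :* (N :+ two)) :* B′ :* (two :* ((N :+ con 1ℚ) :* (N :+ con 1ℚ)) :* (two :* N :+ con (ℕ→ℚ 5))))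
       refl N B′ ⟩
  ℕ→ℚ 2 * ((N + ℕ→ℚ 2) * (N + ℕ→ℚ 2)) * B′ * βᵃ N
    ≡⟨ cong (λ t → ℕ→ℚ 2 * (t * t) * B′ * βᵃ N) (sym n+2) ⟩
  ℕ→ℚ 2 * (ℕ→ℚ (2 ℕ.+ n) * ℕ→ℚ (2 ℕ.+ n)) * B′ * βᵃ N ∎)
  where
  N A′ B B′ c : ℚ
  N  = ℕ→ℚ n
  A′ = Σ[0… suc n ] (invBinomSq (suc n))
  B  = Σ[0… n ] (weightedBeta n)
  B′ = Σ[0… suc n ] (weightedBeta (suc n))
  c  = ℕ→ℚ 6 * ((N + 1ℚ) * (N + 1ℚ)) * (N + ℕ→ℚ 2)
  n+1 : ℕ→ℚ (suc n) ≡ N + 1ℚ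
  n+1 = trans (ℕ→ℚ-suc n) (+-comm 1ℚ N)
  n+2 : ℕ→ℚ (2 ℕ.+ n) ≡ N + ℕ→ℚ 2
  n+2 = trans (ℕ→ℚ-+ 2 n) (+-comm (ℕ→ℚ 2) N)

corollary2 : (n : ℕ) →
  (Σ[0… n ] (λ k → recipℕ (n C k) * recipℕ (n C k))
    ≡ ℕ→ℚ (suc n) * ℕ→ℚ (suc n) * Σ[0… n ] (λ k →
        Σ[0… k ] (λ i → sgn i * recipℕ (suc ((n ∸ k) ℕ.+ i)) * ℕ→ℚ (k C i))
        * Σ[0… k ] (λ i → sgn i * recipℕ (suc ((n ∸ k) ℕ.+ i)) * ℕ→ℚ (k C i))))
  × (Σ[0… n ] (λ k → recipℕ (n C k) * recipℕ (n C k))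
    ≡ ℕ→ℚ (suc n) * ℕ→ℚ (suc n) * Σ[0… n ] (λ k →
        ℕ→ℚ 2 * recipℕ (suc (n ∸ k))
        * Σ[0… k ] (λ i → sgn i * recipℕ (suc (suc n) ℕ.+ i) * ℕ→ℚ (k C i))))
corollary2 n = invBinomSq-sum-betaSum n , (begin
  Σ[0… n ] (invBinomSq n)
    ≡⟨ invBinomSq-sum≡weightedBeta-sum n ⟩
  ℕ→ℚ 2 * (s * s) * Σ[0… n ] (weightedBeta n)
    ≡⟨ solve 3 (λ two s W → two :* (s :* s) :* W := s :* s :* (two :* W)) refl (ℕ→ℚ 2) s (Σ[0… n ] (weightedBeta n)) ⟩
  s * s * (ℕ→ℚ 2 * Σ[0… n ] (weightedBeta n))
    ≡⟨ cong (s * s *_) (sym (trans (Σ-cong n (λ {k} _ → *-assoc (ℕ→ℚ 2) (recipℕ (suc (n ∸ k))) (betaSum (suc n) k)))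
                                   (Σ-*ˡ n (ℕ→ℚ 2) (weightedBeta n)))) ⟩
  s * s * Σ[0… n ] (λ k → ℕ→ℚ 2 * recipℕ (suc (n ∸ k)) * betaSum (suc n) k) ∎)
  where
  s : ℚ
  s = ℕ→ℚ (suc n)
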